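{- If there is an embedding $F:\mathsf{Comp}\to\mathbb N$, then equality between computable partial functions is decidable: for all $f,g:\mathsf{Comp}$, $(f=g)+\neg(f=g)$. In particular, for every computable $f$, either $f$ equals the constant function $\lambda x.\eta(0)$ or it does not.
   Context: Type theory: Martin-Löf type theory with universe $\mathcal U$, function extensionality, proposition extensionality and propositional truncations. $\mathcal L(Y):=\sum_{P:\mathcal U}\operatorname{isProp}(P)\times(P\to Y)$, $\eta(y)=(1,-,\lambda u.y)$. Recursive machine: a pair $m=(i,s)$ of unary primitive recursive functions, $s$ read as $\mathbb N\to\mathbb N+\mathbb N$ via $\mathrm{inl}(n)=2n$, $\mathrm{inr}(n)=2n+1$; $\operatorname{run}_k(m,x):=s'^k(\mathrm{inl}(i(x)))$ where $s'(\mathrm{inl}\,x)=s(x)$, $s'(\mathrm{inr}\,y)=\mathrm{inr}\,y$; $\operatorname{eval}(m)(x)$ has extent $\sum_y\lVert\sum_k\operatorname{run}_k(m,x)=\mathrm{inr}\,y\rVert$ and value the first projection. $\mathsf{isComputable}(f):=\lVert\sum_m f=\operatorname{eval}(m)\rVert$ and $\mathsf{Comp}:=\sum_{f:\mathbb N\to\mathcal L(\mathbb N)}\mathsf{isComputable}(f)$. An embedding is a map whose fibers are propositions. -}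

module Defs where

open import Level using (Level; _⊔_; Setω) renaming (suc to lsuc; zero to lzero)
open import Data.Nat using (ℕ; zero; suc; _≤_; _≤′_; ≤′-reflexive; ≤′-step)
open import Data.Nat.Properties using (≡-irrelevant; ≤-total; ≤⇒≤′)
open import Data.Fin using (Fin)
open import Data.Vec using (Vec; []; _∷_; lookup)
open import Data.Sum using (_⊎_; inj₁; inj₂)
import Data.Sum as Sum
open import Data.Product using (Σ; _×_; _,_; proj₁; proj₂)
open import Data.Unit using (⊤; tt)
open import Relation.Binary.PropositionalEquality using (_≡_; refl; sym; trans; cong)

isProp : ∀ {ℓ} → Set ℓ → Set ℓ
isProp A = (x y : A) → x ≡ y

FunExt : Setω
FunExt = ∀ {a b} {A : Set a} {B : A → Set b} (f g : (x : A) → B x) →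
         ((x : A) → f x ≡ g x) → f ≡ g

PropExt : Set₁
PropExt = (P Q : Set) → isProp P → isProp Q → (P → Q) → (Q → P) → P ≡ Q

record Truncations : Setω where
  field
    ∥_∥      : ∀ {ℓ} → Set ℓ → Set ℓ
    ∣_∣      : ∀ {ℓ} {A : Set ℓ} → A → ∥ A ∥
    ∥∥-isProp : ∀ {ℓ} {A : Set ℓ} → isProp ∥ A ∥
    ∥∥-rec   : ∀ {ℓ ℓ'} {A : Set ℓ} {B : Set ℓ'} → isProp B → (A → B) → ∥ A ∥ → B

isEmbedding : ∀ {a b} {A : Set a} {B : Set b} → (A → B) → Set (a ⊔ b)
isEmbedding {A = A} F = ∀ y → isProp (Σ A (λ x → F x ≡ y))

𝓛 : ∀ {ℓ} → Set ℓ → Set (lsuc lzero ⊔ ℓ)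
𝓛 Y = Σ Set (λ P → isProp P × (P → Y))

η : ∀ {ℓ} {Y : Set ℓ} → Y → 𝓛 Y
η y = ⊤ , (λ _ _ → refl) , (λ _ → y)

data PR : ℕ → Set where
  zeroᶠ : ∀ {n} → PR n
  succᶠ : PR 1
  proj  : ∀ {n} → Fin n → PR n
  comp  : ∀ {n k} → PR k → Vec (PR n) k → PR n
  prec  : ∀ {n} → PR n → PR (suc (suc n)) → PR (suc n)

mutual
  ⟦_⟧ : ∀ {n} → PR n → Vec ℕ n → ℕ
  ⟦ zeroᶠ ⟧ xs = 0
  ⟦ succᶠ ⟧ (x ∷ []) = suc x
  ⟦ proj i ⟧ xs = lookup xs i
  ⟦ comp f gs ⟧ xs = ⟦ f ⟧ (⟦ gs ⟧* xs)
  ⟦ prec f g ⟧ (x ∷ xs) = ⟦rec⟧ f g x xs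

  ⟦_⟧* : ∀ {n k} → Vec (PR n) k → Vec ℕ n → Vec ℕ k
  ⟦ [] ⟧* xs = []
  ⟦ g ∷ gs ⟧* xs = ⟦ g ⟧ xs ∷ ⟦ gs ⟧* xs

  ⟦rec⟧ : ∀ {n} → PR n → PR (suc (suc n)) → ℕ → Vec ℕ n → ℕ
  ⟦rec⟧ f g zero xs = ⟦ f ⟧ xs
  ⟦rec⟧ f g (suc x) xs = ⟦ g ⟧ (⟦rec⟧ f g x xs ∷ x ∷ xs)

⟦_⟧₁ : PR 1 → ℕ → ℕ
⟦ c ⟧₁ x = ⟦ c ⟧ (x ∷ [])

-- ℕ read as ℕ + ℕ via inl(n) = 2n, inr(n) = 2n+1
decode : ℕ → ℕ ⊎ ℕ
decode zero = inj₁ 0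
decode (suc zero) = inj₂ 0
decode (suc (suc n)) = Sum.map suc suc (decode n)

Machine : Set
Machine = PR 1 × PR 1

step : Machine → ℕ ⊎ ℕ → ℕ ⊎ ℕ
step m (inj₁ x) = decode (⟦ proj₂ m ⟧₁ x)
step m (inj₂ y) = inj₂ y

run : ℕ → Machine → ℕ → ℕ ⊎ ℕ
run zero m x = inj₁ (⟦ proj₁ m ⟧₁ x)
run (suc k) m x = step m (run k m x)

run-stable : ∀ {k k'} m x {y} → k ≤′ k' → run k m x ≡ inj₂ y → run k' m x ≡ inj₂ y
run-stable m x (≤′-reflexive refl) e = e
run-stable {k' = suc k'} m x (≤′-step le) e rewrite run-stable m x le e = refl

inj₂-inj : ∀ {y y' : ℕ} → _≡_ {A = ℕ ⊎ ℕ} (inj₂ y) (inj₂ y') → y ≡ y'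
inj₂-inj refl = refl

run-det : ∀ m x {y y'} → Σ ℕ (λ k → run k m x ≡ inj₂ y) → Σ ℕ (λ k → run k m x ≡ inj₂ y') → y ≡ y'
run-det m x (k , e) (k' , e') with ≤-total k k'
... | inj₁ le = inj₂-inj (trans (sym (run-stable m x (≤⇒≤′ le) e)) e')
... | inj₂ le = inj₂-inj (trans (sym e) (run-stable m x (≤⇒≤′ le) e'))

module _ (T : Truncations) where
  open Truncations T

  Halts : Machine → ℕ → Set
  Halts m x = Σ ℕ (λ y → ∥ Σ ℕ (λ k → run k m x ≡ inj₂ y) ∥)

  Halts-isProp : ∀ m x → isProp (Halts m x)
  Halts-isProp m x (y , a) (y' , b) = go (∥∥-rec (λ p q → ≡-irrelevant p q)
      (λ a' → ∥∥-rec (λ p q → ≡-irrelevant p q) (λ b' → run-det m x a' b') b) a) a b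
    where
      go : ∀ {y y'} → y ≡ y' → (a : ∥ Σ ℕ (λ k → run k m x ≡ inj₂ y) ∥)
           (b : ∥ Σ ℕ (λ k → run k m x ≡ inj₂ y') ∥) → (y , a) ≡ (y' , b)
      go refl a b = cong (_ ,_) (∥∥-isProp a b)

  eval : Machine → ℕ → 𝓛 ℕ
  eval m x = Halts m x , Halts-isProp m x , proj₁

  isComputable : (ℕ → 𝓛 ℕ) → Set₁
  isComputable f = ∥ Σ Machine (λ m → f ≡ eval m) ∥

  Comp : Set₁
  Comp = Σ (ℕ → 𝓛 ℕ) isComputable

{-# OPTIONS --safe #-}

-- An embedding into ℕ is injective, and a type injecting into a type with
-- decidable equality inherits it. The second claim is the first applied to
-- f and the computable function λ x → η 0, which is the evaluation of a
-- machine that halts after one step with output 0.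

module Submission where

open import Defs
open import Axiom.UniquenessOfIdentityProofs.WithK using (uip)
open import Data.Nat using (ℕ)
open import Data.Nat.Properties using (_≟_)
open import Data.Sum using (_⊎_; inj₁; inj₂)
open import Data.Product using (_×_; _,_; proj₁)
open import Data.Unit using (⊤; tt)
open import Data.Vec using ([]; _∷_)
open import Function using (_∘_)
open import Relation.Nullary using (¬_; yes; no)
open import Relation.Binary.PropositionalEquality
  using (_≡_; refl; sym; cong; subst)

Discrete : ∀ {a} → Set a → Set a
Discrete A = (x y : A) → (x ≡ y) ⊎ ¬ (x ≡ y)

embedding⇒injective : ∀ {a b} {A : Set a} {B : Set b} {F : A → B} →
  isEmbedding F → ∀ {x y} → F x ≡ F y → x ≡ y
embedding⇒injective emb {x} {y} Fx≡Fy = cong proj₁ (emb _ (x , Fx≡Fy) (y , refl))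

injective-into-ℕ⇒discrete : ∀ {a} {A : Set a} (F : A → ℕ) →
  (∀ {x y} → F x ≡ F y → x ≡ y) → Discrete A
injective-into-ℕ⇒discrete F inj x y with F x ≟ F y
... | yes Fx≡Fy = inj₁ (inj Fx≡Fy)
... | no  Fx≢Fy = inj₂ (Fx≢Fy ∘ cong F)

𝓛-≡ : FunExt → {P Q : Set} (P-prop : isProp P) (Q-prop : isProp Q)
  (v : P → ℕ) (w : Q → ℕ) (P≡Q : P ≡ Q) →
  (∀ p → v p ≡ w (subst (λ X → X) P≡Q p)) →
  _≡_ {A = 𝓛 ℕ} (P , P-prop , v) (Q , Q-prop , w)
𝓛-≡ fe P-prop Q-prop v w refl v≗w
  rewrite fe P-prop Q-prop (λ p → fe (P-prop p) (Q-prop p) (λ q → uip _ _))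
        | fe v w v≗w = refl

halt-on-0 : Machine
halt-on-0 = zeroᶠ , comp succᶠ (zeroᶠ ∷ [])

module _ (T : Truncations) (fe : FunExt) (pe : PropExt) where
  open Truncations T

  eval-halt-on-0 : ∀ x → eval T halt-on-0 x ≡ η 0
  eval-halt-on-0 x = 𝓛-≡ fe (Halts-isProp T halt-on-0 x) (λ _ _ → refl) proj₁ (λ _ → 0)
    Halts≡⊤ output≡0
    where
      Halts≡⊤ : Halts T halt-on-0 x ≡ ⊤
      Halts≡⊤ = pe _ _ (Halts-isProp T halt-on-0 x) (λ _ _ → refl)
        (λ _ → tt) (λ _ → 0 , ∣ 1 , refl ∣)

      output≡0 : (h : Halts T halt-on-0 x) → proj₁ h ≡ 0
      output≡0 (y , halts) = ∥∥-rec uip (λ run≡y → run-det halt-on-0 x run≡y (1 , refl)) halts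

  const-η0 : Comp T
  const-η0 = (λ x → η 0) , ∣ halt-on-0 , sym (fe _ _ eval-halt-on-0) ∣

  Comp-≡ : {f g : Comp T} → proj₁ f ≡ proj₁ g → f ≡ g
  Comp-≡ {f , f-comp} {.f , g-comp} refl = cong (f ,_) (∥∥-isProp f-comp g-comp)

theorem8p6 : (T : Truncations) → FunExt → PropExt →
    (F : Comp T → ℕ) → isEmbedding F →
    ((f g : Comp T) → (f ≡ g) ⊎ ¬ (f ≡ g))
    × ((f : Comp T) → (proj₁ f ≡ (λ x → η 0)) ⊎ ¬ (proj₁ f ≡ (λ x → η 0)))
theorem8p6 T fe pe F emb = Comp-discrete , λ f → equals-η0? f (Comp-discrete f c)
  where
    Comp-discrete : Discrete (Comp T)
    Comp-discrete = injective-into-ℕ⇒discrete F (embedding⇒injective emb)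

    c : Comp T
    c = const-η0 T fe pe

    equals-η0? : (f : Comp T) → (f ≡ c) ⊎ ¬ (f ≡ c) →
      (proj₁ f ≡ (λ x → η 0)) ⊎ ¬ (proj₁ f ≡ (λ x → η 0))
    equals-η0? f (inj₁ f≡c) = inj₁ (cong proj₁ f≡c)
    equals-η0? f (inj₂ f≢c) = inj₂ (f≢c ∘ Comp-≡ T fe pe)
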